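{- Let $G$ be a connected graph. If there exist a positive integer $m$ and $(v,v')\in\mathcal{N}_m(G)$ such that $\eta_m(v,v')=\eta(G)$, $N(v,m)\cup N(v',m)\neq V(G)$ and $4\eta(G)+2<diam(G)$, then $Dim(G)=\mu(G)$.
   Context: Graphs are simple and connected; $d$ is the shortest-path distance, $diam(G)$ the diameter. A set $S\subseteq V(G)$ is a $k$-metric generator if for every pair of distinct vertices $u,v$ there are at least $k$ vertices $w\in S$ with $d(u,w)\neq d(v,w)$; $Dim(G)=k$ means $k$ is the largest integer such that a $k$-metric generator exists. For a vertex $v$ and positive integer $m$: $N(v,m)=\{w: d(v,w)\le m\}$, $S(v,m)=\{w: d(v,w)=m\}$, $\partial N(v,m)=\{w\in S(v,m): d(w,V(G)\setminus N(v,m))=1\}$. Distinct $v,v'$ have equal $m$-boundary if $\partial N(v,m)=\partial N(v',m)\neq\emptyset$; $\mathcal{N}_m(G)$ is the set of such ordered pairs. For $(v,v')\in\mathcal{N}_m(G)$, $\eta_m(v,v')=|\{w\in N(v,m)\cup N(v',m): d(v,w)\neq d(v',w)\}|$; $\eta_m(G)=\min_{\mathcal{N}_m(G)}\eta_m(v,v')$, $\eta(G)=\min_m\eta_m(G)$ (over $m$ with $\mathcal{N}_m(G)\ne\emptyset$). A vertex separator is a set of vertices whose removal disconnects $G$. For distinct $v,v'$, a common separating subset of their $m$-spheres is a set $S\subseteq S(v,m)\cap S(v',m)$ which is a vertex separator such that some component of $G\setminus S$ contains neither $v$ nor $v'$. $\mathcal{P}_m(G)$ is the set of ordered pairs of distinct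 vertices whose $m$-spheres have a common separating subset. For $(v,v')\in\mathcal{P}_m(G)$, $S_m(v,v')$ is the union of all such subsets, $C_m^j$ ($j\in J$) the components of $G\setminus S_m(v,v')$ containing neither $v$ nor $v'$, $\mu_m(v,v')=|\{w\in V(G)\setminus\bigcup_jC_m^j: d(v,w)\neq d(v',w)\}|$; $\mu_m(G)=\min_{\mathcal{P}_m(G)}\mu_m(v,v')$, $\mu(G)=\min_m\mu_m(G)$ (minimum over empty set $=+\infty$). -}

module Defs where

open import Data.Nat using (ℕ; zero; suc; _+_; _*_; _≤_; _<_; _⊔_; _≡ᵇ_)
open import Data.Fin using (Fin; zero; suc)
open import Data.Bool using (Bool; true; false; _∧_; _∨_; not; if_then_else_)
open import Data.Product using (Σ; ∃; ∃-syntax; _×_; _,_)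
open import Data.Sum using (_⊎_)
open import Relation.Binary.PropositionalEquality using (_≡_; _≢_)
open import Relation.Nullary using (¬_)
open import Data.Fin using (_≟_)
open import Relation.Nullary.Decidable using (⌊_⌋)

countF : ∀ {n} → (Fin n → Bool) → ℕ
countF {zero}  f = 0
countF {suc n} f = (if f zero then 1 else 0) + countF (λ i → f (suc i))

anyF : ∀ {n} → (Fin n → Bool) → Bool
anyF {zero}  f = false
anyF {suc n} f = f zero ∨ anyF (λ i → f (suc i))

maxF : ∀ {n} → (Fin n → ℕ) → ℕ
maxF {zero}  f = 0
maxF {suc n} f = f zero ⊔ maxF (λ i → f (suc i))

HasSize : ∀ {n} → (Fin n → Set) → ℕ → Set
HasSize {n} P k =
  Σ (Fin n → Bool) λ f →
    (∀ w → (f w ≡ true → P w) × (P w → f w ≡ true)) × countF f ≡ k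

record Graph : Set where
  field
    n      : ℕ
    adj    : Fin n → Fin n → Bool
    sym    : ∀ x y → adj x y ≡ adj y x
    irrefl : ∀ x → adj x x ≡ false

module _ (G : Graph) where
  open Graph G

  V : Set
  V = Fin n

  -- reachB A k u w : w reachable from u by a walk of length ≤ k along A
  reachB : (V → V → Bool) → ℕ → V → V → Bool
  reachB A zero    u w = ⌊ u ≟ w ⌋
  reachB A (suc k) u w = reachB A k u w ∨ anyF (λ x → reachB A k u x ∧ A x w)

  Connected : Set
  Connected = ∀ u w → ∃[ k ] reachB adj k u w ≡ true

  -- least k ≤ n with reachB adj k u w (a shortest walk has < n edges);
  -- returns n if none (impossible in a connected graph)
  distFrom : ℕ → ℕ → V → V → ℕ
  distFrom k zero      u w = k
  distFrom k (suc fuel) u w = if reachB adj k u w then k else distFrom (suc k) fuel u w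

  d : V → V → ℕ
  d u w = distFrom 0 n u w

  diam : ℕ
  diam = maxF (λ u → maxF (λ w → d u w))

  IsKMetricGenerator : ℕ → (V → Bool) → Set
  IsKMetricGenerator k S =
    ∀ u v → u ≢ v → k ≤ countF (λ w → S w ∧ not (d u w ≡ᵇ d v w))

  IsDim : ℕ → Set
  IsDim k = (∃[ S ] IsKMetricGenerator k S)
          × (∀ k' S → IsKMetricGenerator k' S → k' ≤ k)

  InBall : V → ℕ → V → Set
  InBall v m w = d v w ≤ m

  InBoundary : V → ℕ → V → Set
  InBoundary v m w = d v w ≡ m × ∃[ x ] (adj w x ≡ true × m < d v x)

  EqualBoundary : ℕ → V → V → Set
  EqualBoundary m v v' =
    v ≢ v'
    × (∀ w → (InBoundary v m w → InBoundary v' m w) × (InBoundary v' m w → InBoundary v m w))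
    × ∃[ w ] InBoundary v m w

  EtaM : ℕ → V → V → ℕ → Set
  EtaM m v v' k = HasSize (λ w → (InBall v m w ⊎ InBall v' m w) × d v w ≢ d v' w) k

  IsEta : ℕ → Set
  IsEta e =
    (∃[ m ] (1 ≤ m × ∃[ v ] ∃[ v' ] (EqualBoundary m v v' × EtaM m v v' e)))
    × (∀ m v v' k → 1 ≤ m → EqualBoundary m v v' → EtaM m v v' k → e ≤ k)

  adjMinus : (V → Bool) → V → V → Bool
  adjMinus S a b = adj a b ∧ not (S a) ∧ not (S b)

  ConnIn : (V → Bool) → V → V → Set
  ConnIn S x y = S x ≡ false × S y ≡ false × ∃[ k ] reachB (adjMinus S) k x y ≡ true

  IsSeparator : (V → Bool) → Set
  IsSeparator S = ∃[ a ] ∃[ b ] (S a ≡ false × S b ≡ false × ¬ ConnIn S a b)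

  CommonSepSubset : ℕ → V → V → (V → Bool) → Set
  CommonSepSubset m v v' S =
    (∀ w → S w ≡ true → d v w ≡ m × d v' w ≡ m)
    × IsSeparator S
    × ∃[ x ] (S x ≡ false × ¬ ConnIn S x v × ¬ ConnIn S x v')

  InP : ℕ → V → V → Set
  InP m v v' = v ≢ v' × ∃[ S ] CommonSepSubset m v v' S

  IsSm : ℕ → V → V → (V → Bool) → Set
  IsSm m v v' T = ∀ w → (T w ≡ true → ∃[ S ] (CommonSepSubset m v v' S × S w ≡ true))
                      × (∃[ S ] (CommonSepSubset m v v' S × S w ≡ true) → T w ≡ true)

  InComponents : (V → Bool) → V → V → V → Set
  InComponents T v v' w = T w ≡ false × ¬ ConnIn T w v × ¬ ConnIn T w v'

  MuM : ℕ → V → V → ℕ → Set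
  MuM m v v' k = Σ (V → Bool) λ T → IsSm m v v' T
    × HasSize (λ w → ¬ InComponents T v v' w × d v w ≢ d v' w) k

  IsMu : ℕ → Set
  IsMu μ =
    (∃[ m ] (1 ≤ m × ∃[ v ] ∃[ v' ] (InP m v v' × MuM m v v' μ)))
    × (∀ m v v' k → 1 ≤ m → InP m v v' → MuM m v v' k → μ ≤ k)

-- Let δ(a,b) be the number of vertices distinguishing a and b. Taking all vertices as the
-- generator shows Dim(G) = min δ(a,b) over distinct pairs; fix a minimising pair (a,b).
-- Counting distinguishing vertices along geodesics gives d(a,b) ≤ δ(a,b), and d(a,w) < δ(a,b)
-- when w is nearer to a than to b, so every vertex distinguishing a and b lies within
-- r = 2δ(a,b) of a. Vertices outside N(v,m) ∪ N(v',m) are reached through the common boundary,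
-- hence δ(a,b) ≤ δ(v,v') ≤ η_m(v,v') = e, and 4e + 2 < diam(G) yields a vertex x with
-- d(a,x) > r. The sphere S(a,r) lies in both r-spheres of a and b and separates x from a and b,
-- so (a,b) ∈ 𝒫_r. Conversely, a geodesic from a vertex in a component of G ∖ S_m(u,u') avoiding
-- u and u' to either of them meets S_m(u,u'), on which u and u' are equidistant; hence
-- μ_m(u,u') = δ(u,u') for every pair in 𝒫_m, and μ(G) = δ(a,b) = Dim(G).

module Submission where

open import Defs
open import Data.Nat using (ℕ; _+_; _*_; _≤_; _<_)
open import Data.Product using (_×_; ∃-syntax)
open import Data.Sum using (_⊎_)
open import Relation.Nullary using (¬_)

open import Data.Bool using (Bool; true; false; _∧_; _∨_; not; T; if_then_else_)
open import Data.Bool.Properties using (∨-zeroʳ; T-≡; T-not-≡; ⇔→≡)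
open import Data.Empty using (⊥-elim)
open import Data.Fin using (Fin; zero; suc)
open import Data.Fin.Properties using (any?)
open import Data.Nat using (zero; suc; pred; _∸_; _≡ᵇ_; _<ᵇ_; z≤n; s≤s; z<s; _≤?_; _<?_)
open import Data.Nat.Induction using (<-rec)
open import Data.Nat.Properties
open import Data.Nat.Tactic.RingSolver using (solve-∀)
open import Data.Product using (_,_; proj₁; proj₂)
open import Data.Sum using (inj₁; inj₂)
open import Function using (_∘_)
open import Function.Bundles using (Equivalence; mk⇔)
open import Relation.Binary.Definitions using (tri<; tri≈; tri>)
open import Relation.Binary.PropositionalEquality
open import Relation.Nullary using (yes; no; ¬?; _×-dec_)
open import Relation.Nullary.Decidable using (dec-true; dec-false; isYes≗does)
import Data.Bool as Bool
import Data.Fin as Fin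

open Equivalence using (to; from)

private
  true≢false : true ≢ false
  true≢false ()

  ∧-true⇒ : ∀ {a b} → a ∧ b ≡ true → a ≡ true × b ≡ true
  ∧-true⇒ {true} b≡true = refl , b≡true

  suc-pred-Fin : ∀ {n} → Fin n → suc (n ∸ 1) ≡ n
  suc-pred-Fin {suc n} _ = refl

countF-mono : ∀ {n} {f g : Fin n → Bool} → (∀ w → f w ≡ true → g w ≡ true)
            → countF f ≤ countF g
countF-mono {zero}              f⊆g = z≤n
countF-mono {suc n} {f} {g} f⊆g with f zero in f₀ | g zero in g₀
... | true  | true  = s≤s (countF-mono (f⊆g ∘ suc))
... | true  | false = ⊥-elim (true≢false (trans (sym (f⊆g zero f₀)) g₀))
... | false | true  = m≤n⇒m≤1+n (countF-mono (f⊆g ∘ suc))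
... | false | false = countF-mono (f⊆g ∘ suc)

countF-mono-< : ∀ {n} {f g : Fin n → Bool} → (∀ w → f w ≡ true → g w ≡ true)
              → ∀ w → f w ≡ false → g w ≡ true → countF f < countF g
countF-mono-< {suc n} {f} {g} f⊆g zero fw gw rewrite fw | gw = s≤s (countF-mono (f⊆g ∘ suc))
countF-mono-< {suc n} {f} {g} f⊆g (suc w) fw gw with f zero in f₀ | g zero in g₀
... | true  | true  = s≤s (countF-mono-< (f⊆g ∘ suc) w fw gw)
... | true  | false = ⊥-elim (true≢false (trans (sym (f⊆g zero f₀)) g₀))
... | false | true  = m<n⇒m<1+n (countF-mono-< (f⊆g ∘ suc) w fw gw)
... | false | false = countF-mono-< (f⊆g ∘ suc) w fw gw

countF-cong : ∀ {n} {f g : Fin n → Bool} → (∀ w → f w ≡ g w) → countF f ≡ countF g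
countF-cong {zero}  f≗g = refl
countF-cong {suc n} f≗g rewrite f≗g zero = cong (_ +_) (countF-cong (f≗g ∘ suc))

countF-true : ∀ n → countF {n} (λ _ → true) ≡ n
countF-true zero    = refl
countF-true (suc n) = cong suc (countF-true n)

countF-<-size : ∀ {n} {f : Fin n → Bool} w → f w ≡ false → countF f < n
countF-<-size {n} {f} w fw = subst (countF f <_) (countF-true n) (countF-mono-< (λ _ _ → refl) w fw refl)

countF-pos : ∀ {n} {f : Fin n → Bool} w → f w ≡ true → 1 ≤ countF f
countF-pos {suc n} {f} zero    fw rewrite fw = s≤s z≤n
countF-pos {suc n} {f} (suc w) fw = ≤-trans (countF-pos w fw) (m≤n+m _ _)

range-≤-countF : ∀ {n} (f : Fin n → Bool) (g : Fin n → ℕ) K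
               → (∀ i → i < K → ∃[ w ] (f w ≡ true × g w ≡ i)) → K ≤ countF f
range-≤-countF f g K hits = ≤-trans (K≤countF-below K hits) (countF-mono (below-⊆-f {K}))
  where
  below : ℕ → Fin _ → Bool
  below K w = f w ∧ (g w <ᵇ K)

  below-⊆-f : ∀ {K} w → below K w ≡ true → f w ≡ true
  below-⊆-f w p with f w
  ... | true = refl

  below-⊆-below-suc : ∀ {K} w → below K w ≡ true → below (suc K) w ≡ true
  below-⊆-below-suc {K} w p with f w
  ... | true = to T-≡ (<⇒<ᵇ (m<n⇒m<1+n (<ᵇ⇒< (g w) K (from T-≡ p))))

  K≤countF-below : ∀ K → (∀ i → i < K → ∃[ w ] (f w ≡ true × g w ≡ i))
                 → K ≤ countF (below K)
  K≤countF-below zero    _    = z≤n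
  K≤countF-below (suc K) hits with hits K ≤-refl
  ... | w , fw , gw≡K = ≤-<-trans (K≤countF-below K (λ i → hits i ∘ m<n⇒m<1+n))
                          (countF-mono-< below-⊆-below-suc w new-false new-true)
    where
    new-false : below K w ≡ false
    new-false = cong₂ _∧_ fw (dec-false (g w <? K) (<-irrefl gw≡K))
    new-true : below (suc K) w ≡ true
    new-true = cong₂ _∧_ fw (dec-true (g w <? suc K) (s≤s (≤-reflexive gw≡K)))

HasSize-unique : ∀ {n} {P : Fin n → Set} {k k'} → HasSize P k → HasSize P k' → k ≡ k'
HasSize-unique (f , f⇔P , #f) (g , g⇔P , #g) = trans (sym #f) (trans (countF-cong f≗g) #g)
  where
  f≗g : ∀ w → f w ≡ g w
  f≗g w = ⇔→≡ {z = true} (mk⇔ (proj₂ (g⇔P w) ∘ proj₁ (f⇔P w)) (proj₂ (f⇔P w) ∘ proj₁ (g⇔P w)))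

countF-≤-HasSize : ∀ {n} {P : Fin n → Set} {k} {f : Fin n → Bool}
                 → (∀ w → f w ≡ true → P w) → HasSize P k → countF f ≤ k
countF-≤-HasSize f⊆P (g , g⇔P , #g) = subst (_ ≤_) #g (countF-mono λ w → proj₂ (g⇔P w) ∘ f⊆P w)

anyF-true⇒∃ : ∀ {n} {f : Fin n → Bool} → anyF f ≡ true → ∃[ w ] f w ≡ true
anyF-true⇒∃ {suc n} {f} p with f zero in f₀
... | true  = zero , f₀
... | false with anyF-true⇒∃ p
...   | w , fw = suc w , fw

∃⇒anyF-true : ∀ {n} {f : Fin n → Bool} w → f w ≡ true → anyF f ≡ true
∃⇒anyF-true {suc n} {f} zero    fw rewrite fw = refl
∃⇒anyF-true {suc n} {f} (suc w) fw rewrite ∃⇒anyF-true {f = f ∘ suc} w fw = ∨-zeroʳ (f zero)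

maxF-lub : ∀ {n} {f : Fin n → ℕ} {c} → (∀ i → f i ≤ c) → maxF f ≤ c
maxF-lub {zero}  _    = z≤n
maxF-lub {suc n} f≤c = ⊔-lub (f≤c zero) (maxF-lub (f≤c ∘ suc))

module _ {n} (f : Fin n → Fin n → ℕ) where

  MinimalPairBelow : ℕ → Set
  MinimalPairBelow k = ∃[ a ] ∃[ b ] (a ≢ b × f a b ≤ k × (∀ u u' → u ≢ u' → f a b ≤ f u u'))

  MinimalPairBelow-mono : ∀ {j k} → j ≤ k → MinimalPairBelow j → MinimalPairBelow k
  MinimalPairBelow-mono j≤k (a , b , a≢b , ab≤j , minimal) =
    a , b , a≢b , ≤-trans ab≤j j≤k , minimal

  minimal-pair : ∀ a b → a ≢ b → MinimalPairBelow (f a b)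
  minimal-pair a b a≢b =
    <-rec (λ k → ∀ a b → a ≢ b → f a b ≤ k → MinimalPairBelow k) step _ a b a≢b ≤-refl
    where
    step : ∀ k → (∀ {j} → j < k → ∀ a b → a ≢ b → f a b ≤ j → MinimalPairBelow j)
         → ∀ a b → a ≢ b → f a b ≤ k → MinimalPairBelow k
    step k rec a b a≢b ab≤k with any? (λ u → any? (λ u' → ¬? (u Fin.≟ u') ×-dec (f u u' <? f a b)))
    ... | yes (u , u' , u≢u' , smaller) = MinimalPairBelow-mono (<⇒≤ uu'<k) (rec uu'<k u u' u≢u' ≤-refl)
      where
      uu'<k : f u u' < k
      uu'<k = <-≤-trans smaller ab≤k
    ... | no none =
      a , b , a≢b , ab≤k , λ u u' u≢u' → ≮⇒≥ λ ab>uu' → none (u , u' , u≢u' , ab>uu')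

module _ (G : Graph) (A : V G → V G → Bool) where

  -- A record wrapper makes k, u and w inferable from the type.
  record Reach (k : ℕ) (u w : V G) : Set where
    constructor reach
    field reached : reachB G A k u w ≡ true

  open Reach public

  reach-zero⇒≡ : ∀ {u w} → Reach 0 u w → u ≡ w
  reach-zero⇒≡ {u} {w} (reach r) with u Fin.≟ w
  ... | yes u≡w = u≡w

  reach-suc : ∀ {k u w} → Reach k u w → Reach (suc k) u w
  reach-suc {k} {u} {w} (reach r) = reach (cong (_∨ anyF (λ x → reachB G A k u x ∧ A x w)) r)

  reach-refl : ∀ {k u} → Reach k u u
  reach-refl {zero}  {u} = reach (trans (isYes≗does (u Fin.≟ u)) (dec-true (u Fin.≟ u) refl))
  reach-refl {suc k}     = reach-suc reach-refl

  reach-step : ∀ {k u x w} → Reach k u x → A x w ≡ true → Reach (suc k) u w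
  reach-step {k} {u} {x} {w} (reach r) a =
    reach (trans (cong (reachB G A k u w ∨_) (∃⇒anyF-true x (cong₂ _∧_ r a))) (∨-zeroʳ _))

  reach-edge : ∀ {x w} → A x w ≡ true → Reach 1 x w
  reach-edge = reach-step reach-refl

  reach-suc-cases : ∀ {k u w} → Reach (suc k) u w → Reach k u w ⊎ ∃[ x ] (Reach k u x × A x w ≡ true)
  reach-suc-cases {k} {u} {w} (reach r) with reachB G A k u w in e
  ... | true  = inj₁ (reach e)
  ... | false with anyF-true⇒∃ r
  ...   | x , rx∧a with ∧-true⇒ rx∧a
  ...     | rx , a = inj₂ (x , reach rx , a)

  reach-+ : ∀ {i j u x w} → Reach i u x → Reach j x w → Reach (i + j) u w
  reach-+ {i} {zero} r s with reach-zero⇒≡ s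
  ... | refl = subst (λ k → Reach k _ _) (sym (+-identityʳ i)) r
  reach-+ {i} {suc j} r s rewrite +-suc i j with reach-suc-cases s
  ... | inj₁ s'           = reach-suc (reach-+ r s')
  ... | inj₂ (y , s' , a) = reach-step (reach-+ r s') a

  reach-mono : ∀ {j k u w} → j ≤ k → Reach j u w → Reach k u w
  reach-mono j≤k r with m≤n⇒∃[o]m+o≡n j≤k
  ... | o , j+o≡k = subst (λ k → Reach k _ _) j+o≡k (reach-+ r reach-refl)

  reach-sym : (∀ x y → A x y ≡ A y x) → ∀ {k u w} → Reach k u w → Reach k w u
  reach-sym A-sym {zero} r with reach-zero⇒≡ r
  ... | refl = r
  reach-sym A-sym {suc k} {u} {w} r with reach-suc-cases r
  ... | inj₁ r'           = reach-suc (reach-sym A-sym r')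
  ... | inj₂ (x , r' , a) = reach-+ (reach-edge (trans (A-sym w x) a)) (reach-sym A-sym r')

  reach-preserves : (P : V G → Set) → (∀ {x y} → A x y ≡ true → P x → P y)
                  → ∀ {k u w} → Reach k u w → P u → P w
  reach-preserves P step {zero} r pu with reach-zero⇒≡ r
  ... | refl = pu
  reach-preserves P step {suc k} r pu with reach-suc-cases r
  ... | inj₁ r'           = reach-preserves P step r' pu
  ... | inj₂ (x , r' , a) = step a (reach-preserves P step r' pu)

  module _ (u : V G) where

    Saturated : ℕ → Set
    Saturated k = ∀ {w} → Reach (suc k) u w → Reach k u w

    saturated⇒reach-⊆ : ∀ {k} → Saturated k → ∀ {j w} → Reach j u w → Reach k u w
    saturated⇒reach-⊆ {k} sat {j} r = beyond j (reach-mono (m≤m+n j k) r)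
      where
      beyond : ∀ j {w} → Reach (j + k) u w → Reach k u w
      beyond zero    r = r
      beyond (suc j) r with reach-suc-cases r
      ... | inj₁ r'           = beyond j r'
      ... | inj₂ (x , r' , a) = sat (reach-step (beyond j r') a)

    reach-grows-or-saturates : ∀ k → suc k ≤ countF (reachB G A k u)
                                   ⊎ (∀ {j w} → Reach j u w → Reach k u w)
    reach-grows-or-saturates zero = inj₁ (countF-pos u (reached (reach-refl {0})))
    reach-grows-or-saturates (suc k) with reach-grows-or-saturates k
    ... | inj₂ ⊇all = inj₂ (reach-suc ∘ ⊇all)
    ... | inj₁ grown
      with any? (λ w → (reachB G A (suc k) u w Bool.≟ true) ×-dec (reachB G A k u w Bool.≟ false))
    ...   | yes (w , new , not-old) =
            inj₁ (≤-trans (s≤s grown)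
                          (countF-mono-< (λ _ → reached ∘ reach-suc {k} ∘ reach) w not-old new))
    ...   | no none = inj₂ (reach-suc ∘ saturated⇒reach-⊆ saturated)
      where
      saturated : Saturated k
      saturated {w} (reach r) with reachB G A k u w in e
      ... | true  = reach e
      ... | false = ⊥-elim (none (w , trans (cong (_∨ anyF (λ x → reachB G A k u x ∧ A x w)) e) r , e))

  reach-within-n∸1 : ∀ {k u w} → Reach k u w → Reach (Graph.n G ∸ 1) u w
  reach-within-n∸1 {k} {u} {w} r with reach-grows-or-saturates u (Graph.n G ∸ 1)
  ... | inj₂ ⊇all = ⊇all r
  ... | inj₁ grown with reachB G A (Graph.n G ∸ 1) u w in e
  ...   | true  = reach e
  ...   | false = ⊥-elim (<⇒≱ (countF-<-size w e)
                             (subst (_≤ countF (reachB G A (Graph.n G ∸ 1) u)) (suc-pred-Fin u) grown))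

module _ (G : Graph) where
  open Graph G using (n; adj)

  distFrom-≤ : ∀ fuel {j k u w} → Reach G adj k u w → j ≤ k → distFrom G j fuel u w ≤ k
  distFrom-≤ zero       _ j≤k = j≤k
  distFrom-≤ (suc fuel) {j} {k} {u} {w} (reach r) j≤k with reachB G adj j u w in e
  ... | true  = j≤k
  ... | false = distFrom-≤ fuel (reach r) (≤∧≢⇒< j≤k λ { refl → true≢false (trans (sym r) e) })

  distFrom-reach : ∀ fuel {j k u w} → Reach G adj k u w → j ≤ k → k < j + fuel
                 → Reach G adj (distFrom G j fuel u w) u w
  distFrom-reach zero {j} _ j≤k k<j+0 = ⊥-elim (<⇒≱ k<j+0 (subst (_≤ _) (sym (+-identityʳ j)) j≤k))
  distFrom-reach (suc fuel) {j} {k} {u} {w} (reach r) j≤k k<j+1+fuel with reachB G adj j u w in e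
  ... | true  = reach e
  ... | false = distFrom-reach fuel (reach r) (≤∧≢⇒< j≤k λ { refl → true≢false (trans (sym r) e) })
                  (subst (k <_) (+-suc j fuel) k<j+1+fuel)

  d-≤ : ∀ {k u w} → Reach G adj k u w → d G u w ≤ k
  d-≤ r = distFrom-≤ n r z≤n

  d-refl : ∀ u → d G u u ≡ 0
  d-refl u = n≤0⇒n≡0 (d-≤ (reach-refl G adj {0}))

  distinguishes : V G → V G → V G → Bool
  distinguishes a b w = not (d G a w ≡ᵇ d G b w)

  δ : V G → V G → ℕ
  δ a b = countF (distinguishes a b)

  distinguishes⇒≢ : ∀ a b w → distinguishes a b w ≡ true → d G a w ≢ d G b w
  distinguishes⇒≢ a b w p aw≡bw with d G a w ≡ᵇ d G b w in e
  ... | false = subst T e (≡⇒≡ᵇ (d G a w) (d G b w) aw≡bw)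

  ≢⇒distinguishes : ∀ a b w → d G a w ≢ d G b w → distinguishes a b w ≡ true
  ≢⇒distinguishes a b w aw≢bw with d G a w ≡ᵇ d G b w in e
  ... | true  = ⊥-elim (aw≢bw (≡ᵇ⇒≡ (d G a w) (d G b w) (subst T (sym e) _)))
  ... | false = refl

  δ-sym : ∀ a b → δ a b ≡ δ b a
  δ-sym a b = ≤-antisym (countF-mono (swap a b)) (countF-mono (swap b a))
    where
    swap : ∀ a b w → distinguishes a b w ≡ true → distinguishes b a w ≡ true
    swap a b w p = ≢⇒distinguishes b a w (≢-sym (distinguishes⇒≢ a b w p))

  IsDim-minimal-δ : ∀ {a b} → a ≢ b → (∀ u u' → u ≢ u' → δ a b ≤ δ u u') → IsDim G (δ a b)
  IsDim-minimal-δ {a} {b} a≢b minimal =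
    ((λ _ → true) , minimal) ,
    λ k S S-generates → ≤-trans (S-generates a b a≢b)
                                (countF-mono {f = λ w → S w ∧ distinguishes a b w} (λ w → proj₂ ∘ ∧-true⇒ {S w}))

  adjMinus⇒ : ∀ S {y z} → adjMinus G S y z ≡ true → adj y z ≡ true × S z ≡ false
  adjMinus⇒ S {y} {z} e with ∧-true⇒ {adj y z} e
  ... | yz , off with ∧-true⇒ {not (S y)} off
  ...   | _ , z-off = yz , to T-not-≡ (from T-≡ z-off)

  ConnIn-preserves : ∀ S (P : V G → Set) → (∀ {y z} → adjMinus G S y z ≡ true → P y → P z)
                   → ∀ {x y} → ConnIn G S x y → P x → P y
  ConnIn-preserves S P step (_ , _ , k , r) = reach-preserves G (adjMinus G S) P step {k} (reach r)

module Metric (G : Graph) (conn : Connected G) where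
  open Graph G using (n; adj) renaming (sym to adj-sym)

  d-reach : ∀ u w → Reach G adj (d G u w) u w
  d-reach u w with conn u w
  ... | k , r = distFrom-reach G n (reach-within-n∸1 G adj {k} (reach r)) z≤n (≤-reflexive (suc-pred-Fin u))

  d-triangle : ∀ u x w → d G u w ≤ d G u x + d G x w
  d-triangle u x w = d-≤ G (reach-+ G adj (d-reach u x) (d-reach x w))

  d-sym : ∀ u w → d G u w ≡ d G w u
  d-sym u w = ≤-antisym (d-≤ G (reach-sym G adj adj-sym (d-reach w u)))
                        (d-≤ G (reach-sym G adj adj-sym (d-reach u w)))

  d≡0⇒≡ : ∀ {u w} → d G u w ≡ 0 → u ≡ w
  d≡0⇒≡ {u} {w} d≡0 = reach-zero⇒≡ G adj (subst (λ k → Reach G adj k u w) d≡0 (d-reach u w))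

  adj⇒d≤1 : ∀ {x w} → adj x w ≡ true → d G x w ≤ 1
  adj⇒d≤1 a = d-≤ G (reach-edge G adj a)

  adj⇒d≤1+d : ∀ {u x w} → adj x w ≡ true → d G u w ≤ suc (d G u x)
  adj⇒d≤1+d {u} {x} {w} a = begin
    d G u w           ≤⟨ d-triangle u x w ⟩
    d G u x + d G x w ≤⟨ +-monoʳ-≤ (d G u x) (adj⇒d≤1 a) ⟩
    d G u x + 1       ≡⟨ +-comm (d G u x) 1 ⟩
    suc (d G u x)     ∎
    where open ≤-Reasoning

  d-predecessor : ∀ {u w k} → d G u w ≡ suc k → ∃[ x ] (adj x w ≡ true × d G u x ≡ k)
  d-predecessor {u} {w} {k} uw≡1+k
    with reach-suc-cases G adj (subst (λ k → Reach G adj k u w) uw≡1+k (d-reach u w))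
  ... | inj₁ r           = ⊥-elim (1+n≰n (subst (_≤ k) uw≡1+k (d-≤ G r)))
  ... | inj₂ (x , r , a) =
    x , a , ≤-antisym (d-≤ G r) (≤-pred (subst (_≤ _) uw≡1+k (adj⇒d≤1+d a)))

  geodesic-point : ∀ {u w} i j → d G u w ≡ i + j → ∃[ p ] (d G u p ≡ i × d G p w ≡ j)
  geodesic-point {w = w} i zero uw≡i+0 = w , trans uw≡i+0 (+-identityʳ i) , d-refl G w
  geodesic-point {u} {w} i (suc j) uw≡i+1+j with d-predecessor (trans uw≡i+1+j (+-suc i j))
  ... | x , a , ux≡i+j with geodesic-point i j ux≡i+j
  ...   | p , up≡i , px≡j = p , up≡i , ≤-antisym (≤-trans (adj⇒d≤1+d a) (s≤s (≤-reflexive px≡j)))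
                                                 (+-cancelˡ-≤ i _ _ (begin
    i + suc j         ≡⟨ uw≡i+1+j ⟨
    d G u w           ≤⟨ d-triangle u p w ⟩
    d G u p + d G p w ≡⟨ cong (_+ d G p w) up≡i ⟩
    i + d G p w       ∎))
    where open ≤-Reasoning

  closer⇒suc-d≤δ : ∀ {a b w} → d G a w < d G b w → suc (d G a w) ≤ δ G a b
  closer⇒suc-d≤δ {a} {b} {w} closer = range-≤-countF (distinguishes G a b) (d G a) (suc (d G a w)) level
    where
    level : ∀ i → i < suc (d G a w) → ∃[ p ] (distinguishes G a b p ≡ true × d G a p ≡ i)
    level i (s≤s i≤aw) with m≤n⇒∃[o]m+o≡n i≤aw
    ... | j , i+j≡aw with geodesic-point i j (sym i+j≡aw)
    ...   | p , ap≡i , pw≡j = p , ≢⇒distinguishes G a b p ap≢bp , ap≡i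
      where
      ap≢bp : d G a p ≢ d G b p
      ap≢bp ap≡bp = <⇒≱ closer (begin
        d G b w           ≤⟨ d-triangle b p w ⟩
        d G b p + d G p w ≡⟨ cong₂ _+_ (trans (sym ap≡bp) ap≡i) pw≡j ⟩
        i + j             ≡⟨ i+j≡aw ⟩
        d G a w           ∎)
        where open ≤-Reasoning

  d≤δ : ∀ a b → d G a b ≤ δ G a b
  d≤δ a b = range-≤-countF (distinguishes G a b) height (d G a b) level
    where
    -- Along a geodesic from a to b, the vertices nearer to b are shifted down by one, so that
    -- every height below d a b is attained by a vertex distinguishing a and b.
    height : V G → ℕ
    height p = if d G b p <ᵇ d G a p then pred (d G a p) else d G a p

    Level : ℕ → Set
    Level i = ∃[ p ] (distinguishes G a b p ≡ true × height p ≡ i)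

    level-nearer-a : ∀ {i j} → i ≤ j → d G a b ≡ i + suc j → Level i
    level-nearer-a {i} {j} i≤j ab≡i+1+j with geodesic-point i (suc j) ab≡i+1+j
    ... | p , ap≡i , pb≡1+j = p , ≢⇒distinguishes G a b p (<⇒≢ ap<bp) , height≡
      where
      ap<bp : d G a p < d G b p
      ap<bp = subst₂ _<_ (sym ap≡i) (trans (sym pb≡1+j) (d-sym p b)) (s≤s i≤j)
      height≡ : height p ≡ i
      height≡ with d G b p <ᵇ d G a p in e
      ... | true  = ⊥-elim (<-asym ap<bp (<ᵇ⇒< _ _ (subst T (sym e) _)))
      ... | false = ap≡i

    level-nearer-b : ∀ {i j} → j < i → d G a b ≡ suc i + j → Level i
    level-nearer-b {i} {j} j<i ab≡1+i+j with geodesic-point (suc i) j ab≡1+i+j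
    ... | p , ap≡1+i , pb≡j = p , ≢⇒distinguishes G a b p (≢-sym (<⇒≢ bp<ap)) , height≡
      where
      bp<ap : d G b p < d G a p
      bp<ap = subst₂ _<_ (trans (sym pb≡j) (d-sym p b)) (sym ap≡1+i) (m<n⇒m<1+n j<i)
      height≡ : height p ≡ i
      height≡ with d G b p <ᵇ d G a p in e
      ... | true  = cong pred ap≡1+i
      ... | false = ⊥-elim (subst T e (<⇒<ᵇ bp<ap))

    level : ∀ i → i < d G a b → Level i
    level i i<ab with m≤n⇒∃[o]m+o≡n i<ab
    ... | j , 1+i+j≡ab with i ≤? j
    ...   | yes i≤j = level-nearer-a i≤j (trans (sym 1+i+j≡ab) (sym (+-suc i j)))
    ...   | no i≰j  = level-nearer-b (≰⇒> i≰j) (sym 1+i+j≡ab)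

  distinguished⇒d<δ+δ : ∀ {a b w} → distinguishes G a b w ≡ true → d G a w < δ G a b + δ G a b
  distinguished⇒d<δ+δ {a} {b} {w} p with <-cmp (d G a w) (d G b w)
  ... | tri< aw<bw _ _ = <-≤-trans (closer⇒suc-d≤δ aw<bw) (m≤m+n _ _)
  ... | tri≈ _ aw≡bw _ = ⊥-elim (distinguishes⇒≢ G a b w p aw≡bw)
  ... | tri> _ _ bw<aw = begin-strict
    d G a w           ≤⟨ d-triangle a b w ⟩
    d G a b + d G b w <⟨ +-mono-≤-< (d≤δ a b) (closer⇒suc-d≤δ bw<aw) ⟩
    δ G a b + δ G b a ≡⟨ cong (δ G a b +_) (δ-sym G b a) ⟩
    δ G a b + δ G a b ∎
    where open ≤-Reasoning

  boundary-between : ∀ {v w} m → m < d G v w → ∃[ s ] (InBoundary G v m s × m + d G s w ≤ d G v w)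
  boundary-between {v} {w} m m<vw with m≤n⇒∃[o]m+o≡n m<vw
  ... | j , 1+m+j≡vw with geodesic-point (suc m) j (sym 1+m+j≡vw)
  ...   | p , vp≡1+m , pw≡j with d-predecessor vp≡1+m
  ...     | s , sp , vs≡m = s , (vs≡m , p , sp , ≤-reflexive (sym vp≡1+m)) , (begin
            m + d G s w             ≤⟨ +-monoʳ-≤ m (d-triangle s p w) ⟩
            m + (d G s p + d G p w) ≤⟨ +-monoʳ-≤ m (+-mono-≤ (adj⇒d≤1 sp) (≤-reflexive pw≡j)) ⟩
            m + suc j               ≡⟨ +-suc m j ⟩
            suc m + j               ≡⟨ 1+m+j≡vw ⟩
            d G v w                 ∎)
    where open ≤-Reasoning

  boundary-⊆⇒d≤ : ∀ {v v' m w} → (∀ s → InBoundary G v m s → InBoundary G v' m s)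
                → m < d G v w → d G v' w ≤ d G v w
  boundary-⊆⇒d≤ {v} {v'} {m} {w} ∂v⊆∂v' m<vw with boundary-between m m<vw
  ... | s , s∈∂v , m+sw≤vw = begin
    d G v' w           ≤⟨ d-triangle v' s w ⟩
    d G v' s + d G s w ≡⟨ cong (_+ d G s w) (proj₁ (∂v⊆∂v' s s∈∂v)) ⟩
    m + d G s w        ≤⟨ m+sw≤vw ⟩
    d G v w            ∎
    where open ≤-Reasoning

  EqualBoundary⇒d≡-outside : ∀ {m v v' w} → EqualBoundary G m v v'
                           → ¬ InBall G v m w → ¬ InBall G v' m w → d G v w ≡ d G v' w
  EqualBoundary⇒d≡-outside (_ , ∂v≡∂v' , _) out out' =
    ≤-antisym (boundary-⊆⇒d≤ (proj₂ ∘ ∂v≡∂v') (≰⇒> out'))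
              (boundary-⊆⇒d≤ (proj₁ ∘ ∂v≡∂v') (≰⇒> out))

  δ≤η : ∀ {m v v' e} → EqualBoundary G m v v' → EtaM G m v v' e → δ G v v' ≤ e
  δ≤η {m} {v} {v'} vv'∈𝒩 η≡e =
    countF-≤-HasSize {f = distinguishes G v v'}
                     (λ w p → in-balls w p , distinguishes⇒≢ G v v' w p) η≡e
    where
    in-balls : ∀ w → distinguishes G v v' w ≡ true → InBall G v m w ⊎ InBall G v' m w
    in-balls w p with d G v w ≤? m | d G v' w ≤? m
    ... | yes in₁ | _       = inj₁ in₁
    ... | no _    | yes in₂ = inj₂ in₂
    ... | no out  | no out' =
      ⊥-elim (distinguishes⇒≢ G v v' w p (EqualBoundary⇒d≡-outside vv'∈𝒩 out out'))

  ConnIn-edge : ∀ S {w x c} → adj w x ≡ true → S w ≡ false → ConnIn G S x c → ConnIn G S w c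
  ConnIn-edge S {w} {x} wx Sw (Sx , Sc , j , r) =
    Sw , Sc , suc j , reached (reach-+ G (adjMinus G S) {j = j} (reach-edge G (adjMinus G S) edge) (reach r))
    where
    edge : adjMinus G S w x ≡ true
    edge rewrite wx | Sw | Sx = refl

  geodesic-meets-separator : ∀ S {c w} → S w ≡ false → ¬ ConnIn G S w c
                           → ∃[ t ] (S t ≡ true × d G c t + d G t w ≤ d G c w)
  geodesic-meets-separator S {c} {w} Sw w↛c = descend (d G c w) refl Sw w↛c
    where
    open ≤-Reasoning
    descend : ∀ k {w} → d G c w ≡ k → S w ≡ false → ¬ ConnIn G S w c
            → ∃[ t ] (S t ≡ true × d G c t + d G t w ≤ d G c w)
    descend zero    cw≡0 Sw w↛c with d≡0⇒≡ cw≡0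
    ... | refl = ⊥-elim (w↛c (Sw , Sw , 0 , reached (reach-refl G (adjMinus G S) {0})))
    descend (suc k) {w} cw≡1+k Sw w↛c with d-predecessor cw≡1+k
    ... | x , xw , cx≡k with S x in Sx
    ...   | true  = x , Sx , (begin
            d G c x + d G x w ≤⟨ +-mono-≤ (≤-reflexive cx≡k) (adj⇒d≤1 xw) ⟩
            k + 1             ≡⟨ +-comm k 1 ⟩
            suc k             ≡⟨ cw≡1+k ⟨
            d G c w           ∎)
    ...   | false with descend k cx≡k Sx (w↛c ∘ ConnIn-edge S (trans (adj-sym w x) xw) Sw)
    ...     | t , St , ct+tx≤cx = t , St , (begin
              d G c t + d G t w       ≤⟨ +-monoʳ-≤ (d G c t) (adj⇒d≤1+d xw) ⟩
              d G c t + suc (d G t x) ≡⟨ +-suc (d G c t) (d G t x) ⟩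
              suc (d G c t + d G t x) ≤⟨ s≤s ct+tx≤cx ⟩
              suc (d G c x)           ≡⟨ cong suc cx≡k ⟩
              suc k                   ≡⟨ cw≡1+k ⟨
              d G c w                 ∎)

  components-equidistant : ∀ S {a b w} → (∀ t → S t ≡ true → d G a t ≡ d G b t)
                         → InComponents G S a b w → d G a w ≡ d G b w
  components-equidistant S {a} {b} {w} S-equidistant (Sw , w↛a , w↛b) =
    ≤-antisym (≤-through b a S-equidistant w↛b) (≤-through a b (λ t → sym ∘ S-equidistant t) w↛a)
    where
    ≤-through : ∀ c c' → (∀ t → S t ≡ true → d G c' t ≡ d G c t)
              → ¬ ConnIn G S w c → d G c' w ≤ d G c w
    ≤-through c c' c't≡ct w↛c with geodesic-meets-separator S Sw w↛c
    ... | t , St , ct+tw≤cw = begin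
      d G c' w           ≤⟨ d-triangle c' t w ⟩
      d G c' t + d G t w ≡⟨ cong (_+ d G t w) (c't≡ct t St) ⟩
      d G c t + d G t w  ≤⟨ ct+tw≤cw ⟩
      d G c w            ∎
      where open ≤-Reasoning

  HasSize-distinguishing : ∀ S {a b} → (∀ t → S t ≡ true → d G a t ≡ d G b t)
                         → HasSize (λ w → ¬ InComponents G S a b w × d G a w ≢ d G b w) (δ G a b)
  HasSize-distinguishing S {a} {b} S-equidistant = distinguishes G a b , counted⇔ , refl
    where
    counted⇔ : ∀ w → (distinguishes G a b w ≡ true → ¬ InComponents G S a b w × d G a w ≢ d G b w)
                   × (¬ InComponents G S a b w × d G a w ≢ d G b w → distinguishes G a b w ≡ true)
    counted⇔ w = (λ p → let aw≢bw = distinguishes⇒≢ G a b w p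
                        in aw≢bw ∘ components-equidistant S S-equidistant , aw≢bw)
               , (≢⇒distinguishes G a b w ∘ proj₂)

  MuM≡δ : ∀ {m a b k} → MuM G m a b k → δ G a b ≡ k
  MuM≡δ {a = a} {b} (T , T-is-Sm , size) = HasSize-unique (HasSize-distinguishing T on-both-spheres) size
    where
    on-both-spheres : ∀ t → T t ≡ true → d G a t ≡ d G b t
    on-both-spheres t Tt with proj₁ (T-is-Sm t) Tt
    ... | S , (S-on-spheres , _) , St = trans (proj₁ (S-on-spheres t St)) (sym (proj₂ (S-on-spheres t St)))

  module SphereCut {a b} (a≢b : a ≢ b) (r : ℕ)
                   (inner : ∀ w → distinguishes G a b w ≡ true → d G a w < r)
                   {x} (far : r < d G a x) where

    sphere : V G → Bool
    sphere w = d G a w ≡ᵇ r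

    sphere⇒≡ : ∀ {w} → sphere w ≡ true → d G a w ≡ r
    sphere⇒≡ {w} on = ≡ᵇ⇒≡ (d G a w) r (from T-≡ on)

    ≡⇒sphere : ∀ {w} → d G a w ≡ r → sphere w ≡ true
    ≡⇒sphere {w} aw≡r = to T-≡ (≡⇒≡ᵇ (d G a w) r aw≡r)

    off-sphere⇒≢ : ∀ {w} → sphere w ≡ false → d G a w ≢ r
    off-sphere⇒≢ off aw≡r = true≢false (trans (sym (≡⇒sphere aw≡r)) off)

    ≢⇒off-sphere : ∀ {w} → d G a w ≢ r → sphere w ≡ false
    ≢⇒off-sphere {w} aw≢r with sphere w in on
    ... | true  = ⊥-elim (aw≢r (sphere⇒≡ on))
    ... | false = refl

    sphere-on-both : ∀ w → sphere w ≡ true → d G a w ≡ r × d G b w ≡ r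
    sphere-on-both w on with d G a w ≟ d G b w
    ... | yes aw≡bw = sphere⇒≡ on , trans (sym aw≡bw) (sphere⇒≡ on)
    ... | no aw≢bw  = ⊥-elim (<-irrefl (sphere⇒≡ on) (inner w (≢⇒distinguishes G a b w aw≢bw)))

    inside-closed : ∀ {y z} → adjMinus G sphere y z ≡ true → d G a y < r → d G a z < r
    inside-closed e ay<r with adjMinus⇒ G sphere e
    ... | yz , z-off = ≤∧≢⇒< (≤-trans (adj⇒d≤1+d yz) ay<r) (off-sphere⇒≢ z-off)

    outside-closed : ∀ {y z} → adjMinus G sphere y z ≡ true → r < d G a y → r < d G a z
    outside-closed {y} {z} e r<ay with adjMinus⇒ G sphere e
    ... | yz , z-off = ≤∧≢⇒< (≤-pred (≤-trans r<ay (adj⇒d≤1+d (trans (adj-sym z y) yz))))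
                             (≢-sym (off-sphere⇒≢ z-off))

    b-inside : d G a b < r
    b-inside = inner b (≢⇒distinguishes G a b b λ ab≡bb → a≢b (d≡0⇒≡ (trans ab≡bb (d-refl G b))))

    a-inside : d G a a < r
    a-inside = subst (_< r) (sym (d-refl G a)) (≤-<-trans z≤n b-inside)

    sphere-separates : CommonSepSubset G r a b sphere
    sphere-separates = sphere-on-both
                     , (a , x , a-off , x-off , a↛x)
                     , (x , x-off , x↛ a-inside , x↛ b-inside)
      where
      a↛x : ¬ ConnIn G sphere a x
      a↛x a⇝x = <-asym (ConnIn-preserves G sphere (λ y → d G a y < r) inside-closed a⇝x a-inside) far
      a-off : sphere a ≡ false
      a-off = ≢⇒off-sphere (<⇒≢ a-inside)
      x-off : sphere x ≡ false
      x-off = ≢⇒off-sphere (≢-sym (<⇒≢ far))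
      x↛ : ∀ {c} → d G a c < r → ¬ ConnIn G sphere x c
      x↛ c-inside x⇝c =
        <-asym c-inside (ConnIn-preserves G sphere (λ y → r < d G a y) outside-closed x⇝c far)

    sphere-is-Sm : IsSm G r a b sphere
    sphere-is-Sm w = (λ on → sphere , sphere-separates , on)
                   , λ { (S , (S-on-spheres , _) , Sw) → ≡⇒sphere (proj₁ (S-on-spheres w Sw)) }

    sphere-MuM : MuM G r a b (δ G a b)
    sphere-MuM = sphere , sphere-is-Sm , HasSize-distinguishing sphere equidistant
      where
      equidistant : ∀ t → sphere t ≡ true → d G a t ≡ d G b t
      equidistant t on = trans (proj₁ (sphere-on-both t on)) (sym (proj₂ (sphere-on-both t on)))

  diam≤r+r : ∀ a r → (∀ y → d G a y ≤ r) → diam G ≤ r + r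
  diam≤r+r a r near = maxF-lub {f = λ u → maxF (λ w → d G u w)} λ u → maxF-lub λ w → begin
    d G u w           ≤⟨ d-triangle u a w ⟩
    d G u a + d G a w ≡⟨ cong (_+ d G a w) (d-sym u a) ⟩
    d G a u + d G a w ≤⟨ +-mono-≤ (near u) (near w) ⟩
    r + r             ∎
    where open ≤-Reasoning

  far-vertex : ∀ a r → r + r < diam G → ∃[ x ] r < d G a x
  far-vertex a r r+r<diam with any? (λ x → r <? d G a x)
  ... | yes found = found
  ... | no none   = ⊥-elim (<⇒≱ r+r<diam (diam≤r+r a r λ y → ≮⇒≥ λ r<ay → none (y , r<ay)))

  IsMu-minimal-δ : ∀ {a b} → a ≢ b → (∀ u u' → u ≢ u' → δ G a b ≤ δ G u u')
                 → ∀ {x} → δ G a b + δ G a b < d G a x → IsMu G (δ G a b)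
  IsMu-minimal-δ {a} {b} a≢b minimal far = attained , minimum
    where
    open SphereCut a≢b (δ G a b + δ G a b) (λ _ → distinguished⇒d<δ+δ) far

    attained : ∃[ m ] (1 ≤ m × ∃[ v ] ∃[ v' ] (InP G m v v' × MuM G m v v' (δ G a b)))
    attained = δ G a b + δ G a b , ≤-<-trans z≤n b-inside , a , b , (a≢b , sphere , sphere-separates) , sphere-MuM

    minimum : ∀ m u u' k → 1 ≤ m → InP G m u u' → MuM G m u u' k → δ G a b ≤ k
    minimum m u u' k _ (u≢u' , _) μ = subst (δ G a b ≤_) (MuM≡δ μ) (minimal u u' u≢u')

m≤n⇒[m+m]+[m+m]<4n+2 : ∀ {m n} → m ≤ n → (m + m) + (m + m) < 4 * n + 2
m≤n⇒[m+m]+[m+m]<4n+2 {m} {n} m≤n = begin-strict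
  (m + m) + (m + m) ≤⟨ +-mono-≤ (+-mono-≤ m≤n m≤n) (+-mono-≤ m≤n m≤n) ⟩
  (n + n) + (n + n) ≡⟨ [n+n]+[n+n]≡4n n ⟩
  4 * n             <⟨ m<m+n (4 * n) z<s ⟩
  4 * n + 2         ∎
  where
  open ≤-Reasoning
  [n+n]+[n+n]≡4n : ∀ n → (n + n) + (n + n) ≡ 4 * n
  [n+n]+[n+n]≡4n = solve-∀

proposition2p17 : (G : Graph) → Connected G
    → (m : ℕ) → 1 ≤ m → (v v' : V G) → EqualBoundary G m v v'
    → (e : ℕ) → IsEta G e → EtaM G m v v' e
    → (∃[ w ] ¬ (InBall G v m w ⊎ InBall G v' m w))
    → 4 * e + 2 < diam G
    → ∃[ k ] (IsDim G k × IsMu G k)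
proposition2p17 G conn m _ v v' vv'∈𝒩 e _ η≡e _ 4e+2<diam =
  let a , b , a≢b , δab≤δvv' , minimal = minimal-pair (δ G) v v' (proj₁ vv'∈𝒩)
      x , far = far-vertex a (δ G a b + δ G a b)
                  (<-trans (m≤n⇒[m+m]+[m+m]<4n+2 (≤-trans δab≤δvv' (δ≤η vv'∈𝒩 η≡e))) 4e+2<diam)
  in δ G a b , IsDim-minimal-δ G a≢b minimal , IsMu-minimal-δ a≢b minimal far
  where open Metric G conn
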